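{- Let $c(n,3)$, $n\ge 0$, be defined by $(1-9x)^{ -1/3}=\sum_{n\ge 0}c(n,3)x^n$. Let $p\ne 3$ be a prime and write $n=a_0+a_1p+\cdots+a_dp^d$ in base $p$ (digits $0\le a_j\le p-1$). Then $p$ does not divide $c(n,3)$ if and only if for every $j$ with $0\le j\le d$, $$a_j<\begin{cases} p/3 & \text{if } j \text{ is odd or } p\equiv 1 \pmod 3,\\ 2p/3 & \text{otherwise.}\end{cases}$$ -}

module Defs where

open import Data.Nat using (ℕ; zero; suc; _+_; _*_; _^_; _/_; _%_; _!; NonZero)
open import Data.Nat.Properties using (_!≢0; m^n≢0)
open import Relation.Binary.PropositionalEquality using (_≡_; refl)

-- Expanding (1 - 9x)^(-1/3) by the binomial series:
--   c(n,3) = (-9)^n * binom(-1/3, n)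
--          = 9^n * (1/3)(4/3)...((3n-2)/3) / n!
--          = 3^n * ∏_{k<n} (3k+1) / n!
-- The division below is exact (c(n,3) is an integer).

prod3k+1 : ℕ → ℕ
prod3k+1 zero    = 1
prod3k+1 (suc n) = prod3k+1 n * (3 * n + 1)

c3 : ℕ → ℕ
c3 n = (3 ^ n * prod3k+1 n) / (n !) where instance _ = n !≢0

digit : (b : ℕ) .{{_ : NonZero b}} → ℕ → ℕ → ℕ
digit b j n = (n / b ^ j) % b where instance _ = m^n≢0 b j

_ : c3 0 ≡ 1
_ = refl
_ : c3 1 ≡ 3
_ = refl
_ : c3 2 ≡ 18
_ = refl
_ : c3 3 ≡ 126
_ = refl
_ : digit 5 1 37 ≡ 2
_ = refl

-- Since c(n,3) · n! = 3^n · ∏_{k<n} (3k+1) and p ∤ 3, p ∤ c(n,3) iff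
-- v_p(n!) = v_p(∏_{k<n} (3k+1)), v_p the p-adic valuation.  Both sides are
-- computed digit by digit.  In a progression product ∏_{k<n} (ck+s) with
-- p ∤ c the multiples of p are the factors with k ≡ r (mod p), where
-- p ∣ cr + s, and c(r + pi) + s = p (ci + s′) with s′ = (cr + s)/p.  So for
-- n = a + pm the valuation is m + v(∏_{i<m} (ci+s′)) if a ≤ r and
-- (m+1) + v(∏_{i<m+1} (ci+s′)) if a > r (the block recursion); c = s = 1 is
-- Legendre's v(n!) = m + v(m!).  By strong induction on n, for offsets s_j
-- with c r_j + s_j = p s_{j+1}: v(n!) ≤ v(∏ (ck+s_0)), with equality iff
-- every digit a_j ≤ r_j (the digit criterion).  For c = 3, s_0 = 1 the
-- offsets stay 1 (p = 3t+1, r_j = t) or alternate 1, 2 (p = 3t+2, r_j =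
-- 2t+1, t), which are exactly the bounds of the theorem.  The inequality
-- for all primes ≠ 3, with v_3(n!) ≤ n, also shows that n! divides the
-- numerator, so the truncating division defining c(n,3) is exact.
module Submission where

open import Data.Empty using (⊥; ⊥-elim)
open import Data.List using (_∷_)
open import Data.List.Relation.Unary.All using (All; []; _∷_)
open import Data.Nat
open import Data.Nat.DivMod
open import Data.Nat.Divisibility
open import Data.Nat.Induction using (<-rec)
open import Data.Nat.ListAction using (product)
open import Data.Nat.Primality
  using (Prime; prime?; prime⇒nonZero; prime⇒nonTrivial; prime⇒irreducible; euclidsLemma; productOfPrimes≢0)
open import Data.Nat.Primality.Factorisation using (factorise; PrimeFactorisation)
open import Data.Nat.Properties
open import Data.Nat.Tactic.RingSolver using (solve-∀)
open import Data.Product using (_×_; _,_; proj₁; proj₂; ∃-syntax)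
open import Data.Sum using (_⊎_; inj₁; inj₂; [_,_]′)
open import Function.Bundles using (_⇔_; mk⇔; Equivalence)
open import Function.Construct.Composition using (_⇔-∘_)
open import Function.Construct.Symmetry using (⇔-sym)
open import Relation.Binary.Definitions using (Tri; tri<; tri≈; tri>)
open import Relation.Binary.PropositionalEquality
open import Relation.Nullary using (¬_; Dec; yes; no)
open import Relation.Nullary.Decidable using (from-yes)

open import Defs

∏ : ℕ → ℕ → ℕ → ℕ
∏ c s zero    = 1
∏ c s (suc n) = ∏ c s n * (c * n + s)

c*n+s≢0 : ∀ c n {s} → s ≢ 0 → c * n + s ≢ 0
c*n+s≢0 c n s≢0 eq = s≢0 (m+n≡0⇒n≡0 (c * n) eq)

∏≢0 : ∀ c {s} n → s ≢ 0 → ∏ c s n ≢ 0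
∏≢0 c zero    s≢0 ()
∏≢0 c (suc n) s≢0 eq with m*n≡0⇒m≡0∨n≡0 (∏ c _ n) eq
... | inj₁ ∏≡0 = ∏≢0 c n s≢0 ∏≡0
... | inj₂ f≡0 = c*n+s≢0 c n s≢0 f≡0

!≡∏ : ∀ n → n ! ≡ ∏ 1 1 n
!≡∏ zero    = refl
!≡∏ (suc n) = begin
  suc n * n !        ≡⟨ *-comm (suc n) (n !) ⟩
  n ! * suc n        ≡⟨ cong₂ _*_ (!≡∏ n) (+-comm 1 n) ⟩
  ∏ 1 1 n * (n + 1)  ≡⟨ cong (λ k → ∏ 1 1 n * (k + 1)) (sym (*-identityˡ n)) ⟩
  ∏ 1 1 (suc n)      ∎
  where open ≡-Reasoning

prod3k+1≡∏ : ∀ n → prod3k+1 n ≡ ∏ 3 1 n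
prod3k+1≡∏ zero    = refl
prod3k+1≡∏ (suc n) = cong (_* (3 * n + 1)) (prod3k+1≡∏ n)

-- The q-adic valuation, for a fixed prime q.  It is characterised
-- relationally first (x = q ^ e * u with q ∤ u), then turned into a
-- total function val with val 0 = 0.
module Valuation (q : ℕ) (qp : Prime q) where

  instance
    q-nonZero : NonZero q
    q-nonZero = prime⇒nonZero qp

  1<q : 1 < q
  1<q = nonTrivial⇒n>1 q {{prime⇒nonTrivial qp}}

  q∤1 : ¬ q ∣ 1
  q∤1 q∣1 = <⇒≱ 1<q (∣⇒≤ q∣1)

  _HasValuation_ : ℕ → ℕ → Set
  x HasValuation e = ∃[ u ] x ≡ q ^ e * u × ¬ q ∣ u

  q∣q^[1+e]*u : ∀ e u → q ∣ q ^ suc e * u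
  q∣q^[1+e]*u e u = ∣m⇒∣m*n u (m∣m*n (q ^ e))

  hasValuation≢0 : ∀ {x e} → x HasValuation e → x ≢ 0
  hasValuation≢0 {e = e} (u , refl , q∤u) x≡0 with m*n≡0⇒m≡0∨n≡0 (q ^ e) x≡0
  ... | inj₁ q^e≡0 = ≢-nonZero⁻¹ (q ^ e) {{m^n≢0 q e}} q^e≡0
  ... | inj₂ refl  = q∤u (q ∣0)

  hasValuation-unique : ∀ {x e f} → x HasValuation e → x HasValuation f → e ≡ f
  hasValuation-unique {e = zero}  {zero}  _ _ = refl
  hasValuation-unique {e = zero}  {suc f} (u , refl , q∤u) (w , eq , _) =
    ⊥-elim (q∤u (subst (q ∣_) (trans (sym eq) (*-identityˡ u)) (q∣q^[1+e]*u f w)))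
  hasValuation-unique {e = suc e} {zero}  (u , eq , _) (w , refl , q∤w) =
    ⊥-elim (q∤w (subst (q ∣_) (trans (sym eq) (*-identityˡ w)) (q∣q^[1+e]*u e u)))
  hasValuation-unique {e = suc e} {suc f} (u , refl , q∤u) (w , eq , q∤w) =
    cong suc (hasValuation-unique (u , refl , q∤u) (w , cancel , q∤w))
    where
    cancel : q ^ e * u ≡ q ^ f * w
    cancel = *-cancelˡ-≡ _ _ q (trans (sym (*-assoc q (q ^ e) u))
                                 (trans eq (*-assoc q (q ^ f) w)))

  hasValuation-exists : ∀ x → x ≢ 0 → ∃[ e ] x HasValuation e
  hasValuation-exists = <-rec _ step
    where
    step : ∀ x → (∀ {y} → y < x → y ≢ 0 → ∃[ e ] y HasValuation e) →
           x ≢ 0 → ∃[ e ] x HasValuation e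
    step x rec x≢0 with q ∣? x
    ... | no q∤x = 0 , x , sym (*-identityˡ x) , q∤x
    ... | yes (divides y refl) with rec y<y*q y≢0
      where
      y≢0 : y ≢ 0
      y≢0 refl = x≢0 refl
      y<y*q : y < y * q
      y<y*q = m<m*n y q {{≢-nonZero y≢0}} 1<q
    ...   | e , u , refl , q∤u = suc e , u , y*q≡ , q∤u
      where
      y*q≡ : q ^ e * u * q ≡ q ^ suc e * u
      y*q≡ = trans (*-comm (q ^ e * u) q) (sym (*-assoc q (q ^ e) u))

  val : ℕ → ℕ
  val x with x ≟ 0
  ... | yes _   = 0
  ... | no x≢0 = proj₁ (hasValuation-exists x x≢0)

  val-spec : ∀ {x} → x ≢ 0 → x HasValuation val x
  val-spec {x} x≢0 with x ≟ 0
  ... | yes x≡0  = ⊥-elim (x≢0 x≡0)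
  ... | no x≢0′ = proj₂ (hasValuation-exists x x≢0′)

  val-unique : ∀ {x e} → x HasValuation e → val x ≡ e
  val-unique {e = e} v = hasValuation-unique (val-spec (hasValuation≢0 {e = e} v)) v

  val-* : ∀ {x y} → x ≢ 0 → y ≢ 0 → val (x * y) ≡ val x + val y
  val-* {x} {y} x≢0 y≢0 with val-spec x≢0 | val-spec y≢0
  ... | u , x≡ , q∤u | w , y≡ , q∤w = val-unique (u * w , xy≡ , q∤uw)
    where
    xy≡ : x * y ≡ q ^ (val x + val y) * (u * w)
    xy≡ = begin
      x * y                              ≡⟨ cong₂ _*_ x≡ y≡ ⟩
      q ^ val x * u * (q ^ val y * w)    ≡⟨ interchange (q ^ val x) (q ^ val y) u w ⟩
      q ^ val x * q ^ val y * (u * w)    ≡⟨ cong (_* (u * w)) (sym (^-distribˡ-+-* q (val x) (val y))) ⟩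
      q ^ (val x + val y) * (u * w)      ∎
      where
      open ≡-Reasoning
      interchange : ∀ a b c d → a * c * (b * d) ≡ a * b * (c * d)
      interchange = solve-∀
    q∤uw : ¬ q ∣ u * w
    q∤uw q∣uw = [ q∤u , q∤w ]′ (euclidsLemma u w qp q∣uw)

  val-∤ : ∀ {x} → ¬ q ∣ x → val x ≡ 0
  val-∤ {x} q∤x = val-unique (x , sym (*-identityˡ x) , q∤x)

  val-q^ : ∀ n → val (q ^ n) ≡ n
  val-q^ n = val-unique (1 , sym (*-identityʳ (q ^ n)) , q∤1)

  val-q : val q ≡ 1
  val-q = trans (cong val (sym (*-identityʳ q))) (val-q^ 1)

  val-q* : ∀ {x} → x ≢ 0 → val (q * x) ≡ suc (val x)
  val-q* {x} x≢0 = trans (val-* (≢-nonZero⁻¹ q) x≢0) (cong (_+ val x) val-q)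

  val-^-∤ : ∀ {a} n → ¬ q ∣ a → val (a ^ n) ≡ 0
  val-^-∤ {a} n q∤a = val-∤ (q∤a^ n)
    where
    q∤a^ : ∀ n → ¬ q ∣ a ^ n
    q∤a^ zero    = q∤1
    q∤a^ (suc n) q∣a^[1+n] = [ q∤a , q∤a^ n ]′ (euclidsLemma a (a ^ n) qp q∣a^[1+n])

  val>0⇒∣ : ∀ {x} → x ≢ 0 → 0 < val x → q ∣ x
  val>0⇒∣ {x} x≢0 0<val with val x | val-spec x≢0
  ... | suc e | u , refl , _ = q∣q^[1+e]*u e u

  ∤⇔val≡0 : ∀ {x} → x ≢ 0 → (¬ q ∣ x) ⇔ (val x ≡ 0)
  ∤⇔val≡0 {x} x≢0 = mk⇔ val-∤ val≡0⇒∤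
    where
    val≡0⇒∤ : val x ≡ 0 → ¬ q ∣ x
    val≡0⇒∤ val≡0 (divides y refl) = 0≢1+n (trans (sym val≡0) (val-q*y))
      where
      val-q*y : val (y * q) ≡ suc (val y)
      val-q*y = trans (cong val (*-comm y q)) (val-q* (λ { refl → x≢0 refl }))

  val-∏-suc : ∀ c {s} n → s ≢ 0 → val (∏ c s (suc n)) ≡ val (∏ c s n) + val (c * n + s)
  val-∏-suc c n s≢0 = val-* (∏≢0 c n s≢0) (c*n+s≢0 c n s≢0)

  val-∏-mono : ∀ c {s} n → s ≢ 0 → val (∏ c s n) ≤ val (∏ c s (suc n))
  val-∏-mono c n s≢0 = subst (val (∏ c _ n) ≤_) (sym (val-∏-suc c n s≢0)) (m≤m+n _ _)

-- Among the factors
-- c * k + s exactly those with k ≡ r (mod q) are multiples of q, and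
-- c * (r + q * i) + s = q * (c * i + s'); so the multiples of q among the
-- first a + q * m factors contribute q times the first m (or m + 1, when
-- a > r) factors of the progression with offset s'.
module Block (q : ℕ) (qp : Prime q) {c s r s′ : ℕ} (q∤c : ¬ q ∣ c) (r<q : r < q)
             (c*r+s≡q*s′ : c * r + s ≡ q * s′) (s≢0 : s ≢ 0) (s′≢0 : s′ ≢ 0) where
  open Valuation q qp

  residue-unique : ∀ {a b} → a < b → b < q → q ∣ c * a + s → ¬ q ∣ c * b + s
  residue-unique {a} {b} a<b b<q q∣a q∣b = [ q∤c , q∤b∸a ]′ (euclidsLemma c (b ∸ a) qp q∣c[b∸a])
    where
    split : c * b + s ≡ (c * a + s) + c * (b ∸ a)
    split = begin
      c * b + s                   ≡⟨ cong (λ k → c * k + s) (sym (m+[n∸m]≡n (<⇒≤ a<b))) ⟩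
      c * (a + (b ∸ a)) + s       ≡⟨ regroup c a (b ∸ a) s ⟩
      (c * a + s) + c * (b ∸ a)   ∎
      where
      open ≡-Reasoning
      regroup : ∀ c a d s → c * (a + d) + s ≡ (c * a + s) + c * d
      regroup = solve-∀
    q∣c[b∸a] : q ∣ c * (b ∸ a)
    q∣c[b∸a] = ∣m+n∣m⇒∣n (subst (q ∣_) split q∣b) q∣a
    q∤b∸a : ¬ q ∣ b ∸ a
    q∤b∸a q∣b∸a = <⇒≱ (≤-<-trans (m∸n≤m b a) b<q) (∣⇒≤ {{>-nonZero (m<n⇒0<n∸m a<b)}} q∣b∸a)

  shift-factor : ∀ a m → c * (a + q * m) + s ≡ q * (c * m) + (c * a + s)
  shift-factor a m = regroup c a q m s
    where
    regroup : ∀ c a q m s → c * (a + q * m) + s ≡ q * (c * m) + (c * a + s)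
    regroup = solve-∀

  val-factor-off : ∀ {a} m → a < q → a ≢ r → val (c * (a + q * m) + s) ≡ 0
  val-factor-off {a} m a<q a≢r = val-∤ q∤factor
    where
    q∤factor : ¬ q ∣ c * (a + q * m) + s
    q∤factor q∣factor = by-trichotomy (<-cmp a r)
      where
      q∣a : q ∣ c * a + s
      q∣a = ∣m+n∣m⇒∣n (subst (q ∣_) (shift-factor a m) q∣factor) (m∣m*n (c * m))
      q∣r : q ∣ c * r + s
      q∣r = subst (q ∣_) (sym c*r+s≡q*s′) (m∣m*n s′)
      by-trichotomy : Tri (a < r) (a ≡ r) (r < a) → ⊥
      by-trichotomy (tri< a<r _ _) = residue-unique a<r r<q q∣a q∣r
      by-trichotomy (tri≈ _ a≡r _) = a≢r a≡r
      by-trichotomy (tri> _ _ r<a) = residue-unique r<a a<q q∣r q∣a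

  val-factor-on : ∀ m → val (c * (r + q * m) + s) ≡ suc (val (c * m + s′))
  val-factor-on m = begin
    val (c * (r + q * m) + s)       ≡⟨ cong val (shift-factor r m) ⟩
    val (q * (c * m) + (c * r + s)) ≡⟨ cong (λ k → val (q * (c * m) + k)) c*r+s≡q*s′ ⟩
    val (q * (c * m) + q * s′)      ≡⟨ cong val (sym (*-distribˡ-+ q (c * m) s′)) ⟩
    val (q * (c * m + s′))          ≡⟨ val-q* (c*n+s≢0 c m s′≢0) ⟩
    suc (val (c * m + s′))          ∎
    where open ≡-Reasoning

  -- The block recursion, by induction on the position a within block m;
  -- position 0 of block m + 1 is position q of block m.
  block : ∀ m a → a ≤ q →
          (a ≤ r → val (∏ c s (a + q * m)) ≡ m + val (∏ c s′ m)) ×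
          (r < a → val (∏ c s (a + q * m)) ≡ suc m + val (∏ c s′ (suc m)))
  block zero    zero _ rewrite *-zeroʳ q = (λ _ → refl) , (λ ())
  block (suc m) zero _ rewrite *-suc q m = (λ _ → proj₂ (block m q ≤-refl) r<q) , (λ ())
  block m (suc a) 1+a≤q with <-cmp a r | block m a (<⇒≤ 1+a≤q)
  ... | tri< a<r a≢r _ | below , _ =
    (λ _ → begin
      val (∏ c s (suc a + q * m))                       ≡⟨ val-∏-suc c (a + q * m) s≢0 ⟩
      val (∏ c s (a + q * m)) + val (c * (a + q * m) + s) ≡⟨ cong₂ _+_ (below (<⇒≤ a<r)) (val-factor-off m 1+a≤q a≢r) ⟩
      m + val (∏ c s′ m) + 0                             ≡⟨ +-identityʳ _ ⟩
      m + val (∏ c s′ m)                                 ∎) ,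
    (λ r<1+a → ⊥-elim (<⇒≱ a<r (≤-pred r<1+a)))
    where open ≡-Reasoning
  ... | tri≈ _ refl _ | below , _ =
    (λ 1+r≤r → ⊥-elim (<-irrefl refl 1+r≤r)) ,
    (λ _ → begin
      val (∏ c s (suc r + q * m))                       ≡⟨ val-∏-suc c (r + q * m) s≢0 ⟩
      val (∏ c s (r + q * m)) + val (c * (r + q * m) + s)  ≡⟨ cong₂ _+_ (below ≤-refl) (val-factor-on m) ⟩
      m + val (∏ c s′ m) + suc (val (c * m + s′))         ≡⟨ regroup m _ _ ⟩
      suc m + (val (∏ c s′ m) + val (c * m + s′))         ≡⟨ cong (suc m +_) (sym (val-∏-suc c m s′≢0)) ⟩
      suc m + val (∏ c s′ (suc m))                        ∎)
    where
    open ≡-Reasoning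
    regroup : ∀ x y z → x + y + suc z ≡ suc x + (y + z)
    regroup = solve-∀
  ... | tri> _ a≢r r<a | _ , above =
    (λ 1+a≤r → ⊥-elim (<⇒≱ r<a (≤-trans (n≤1+n a) 1+a≤r))) ,
    (λ _ → begin
      val (∏ c s (suc a + q * m))                       ≡⟨ val-∏-suc c (a + q * m) s≢0 ⟩
      val (∏ c s (a + q * m)) + val (c * (a + q * m) + s) ≡⟨ cong₂ _+_ (above r<a) (val-factor-off m 1+a≤q a≢r) ⟩
      suc m + val (∏ c s′ (suc m)) + 0                   ≡⟨ +-identityʳ _ ⟩
      suc m + val (∏ c s′ (suc m))                       ∎)
    where open ≡-Reasoning

module _ {q : ℕ} .{{_ : NonZero q}} where

  divmod : ∀ n → n ≡ n % q + q * (n / q)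
  divmod n = trans (m≡m%n+[m/n]*n n q) (cong (n % q +_) (*-comm (n / q) q))

  digit-zero : ∀ n → digit q 0 n ≡ n % q
  digit-zero n = cong (_% q) (n/1≡n n)

  digit-suc : ∀ i n → digit q (suc i) n ≡ digit q i (n / q)
  digit-suc i n = cong (_% q) (sym (m/n/o≡m/[n*o] n q (q ^ i) {{_}} {{m^n≢0 q i}} {{m^n≢0 q (suc i)}}))

  digit-of-0 : ∀ i → digit q i 0 ≡ 0
  digit-of-0 i = trans (cong (_% q) (0/n≡0 (q ^ i) {{m^n≢0 q i}})) (m*n%n≡0 0 q)

  digits-split : ∀ (P : ℕ → ℕ → Set) n →
                 (∀ i → P i (digit q i n)) ⇔ (P 0 (n % q) × ∀ i → P (suc i) (digit q i (n / q)))
  digits-split P n = mk⇔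
    (λ all → subst (P 0) (digit-zero n) (all 0) , λ i → subst (P (suc i)) (digit-suc i n) (all (suc i)))
    (λ { (low , high) zero    → subst (P 0) (sym (digit-zero n)) low
       ; (low , high) (suc i) → subst (P (suc i)) (sym (digit-suc i n)) (high i) })

-- Legendre's recursion val ((a + q m) !) = m + val (m !): the case
-- c = s = s′ = 1, r = q - 1 of the block recursion.
module Legendre (q : ℕ) (qp : Prime q) where
  open Valuation q qp

  private
    pred-q<q : pred q < q
    pred-q<q = subst (pred q <_) (suc-pred q) (n<1+n (pred q))

    1*pred-q+1≡q*1 : 1 * pred q + 1 ≡ q * 1
    1*pred-q+1≡q*1 = begin
      1 * pred q + 1   ≡⟨ cong (_+ 1) (*-identityˡ (pred q)) ⟩
      pred q + 1       ≡⟨ +-comm (pred q) 1 ⟩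
      suc (pred q)     ≡⟨ suc-pred q ⟩
      q                ≡⟨ sym (*-identityʳ q) ⟩
      q * 1            ∎
      where open ≡-Reasoning

    open Block q qp q∤1 pred-q<q 1*pred-q+1≡q*1 (λ ()) (λ ())

  legendre : ∀ m {a} → a < q → val ((a + q * m) !) ≡ m + val (m !)
  legendre m {a} a<q = begin
    val ((a + q * m) !)       ≡⟨ cong val (!≡∏ (a + q * m)) ⟩
    val (∏ 1 1 (a + q * m))   ≡⟨ proj₁ (block m a (<⇒≤ a<q)) (<⇒≤pred a<q) ⟩
    m + val (∏ 1 1 m)         ≡⟨ cong (λ k → m + val k) (sym (!≡∏ m)) ⟩
    m + val (m !)             ∎
    where open ≡-Reasoning

  val-!≤ : ∀ n → val (n !) ≤ n
  val-!≤ = <-rec _ step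
    where
    step : ∀ n → (∀ {m} → m < n → val (m !) ≤ m) → val (n !) ≤ n
    step zero    _   = ≤-reflexive (val-∤ q∤1)
    step n@(suc _) rec = begin
      val (n !)                   ≡⟨ cong (λ k → val (k !)) (divmod {q} n) ⟩
      val ((a + q * m) !)         ≡⟨ legendre m (m%n<n n q) ⟩
      m + val (m !)               ≤⟨ +-monoʳ-≤ m (rec (m/n<m n q 1<q)) ⟩
      m + m                       ≡⟨ cong (m +_) (sym (+-identityʳ m)) ⟩
      2 * m                       ≤⟨ *-monoˡ-≤ m 1<q ⟩
      q * m                       ≤⟨ m≤n+m (q * m) a ⟩
      a + q * m                   ≡⟨ sym (divmod {q} n) ⟩
      n                           ∎
      where
      open ≤-Reasoning
      a = n % q
      m = n / q

module DigitCriterion (q : ℕ) (qp : Prime q) {c : ℕ} (q∤c : ¬ q ∣ c) (s r : ℕ → ℕ)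
                      (r<q : ∀ j → r j < q) (c*r+s≡q*s : ∀ j → c * r j + s j ≡ q * s (suc j))
                      (s≢0 : ∀ j → s j ≢ 0) where
  open Valuation q qp
  open Legendre q qp

  valΠ : ℕ → ℕ → ℕ
  valΠ j n = val (∏ c (s j) n)

  module BlockAt (j : ℕ) = Block q qp q∤c (r<q j) (c*r+s≡q*s j) (s≢0 j) (s≢0 (suc j))

  split-! : ∀ n → val (n !) ≡ n / q + val ((n / q) !)
  split-! n = trans (cong (λ k → val (k !)) (divmod {q} n)) (legendre (n / q) (m%n<n n q))

  split-low : ∀ j n → n % q ≤ r j → valΠ j n ≡ n / q + valΠ (suc j) (n / q)
  split-low j n a≤r = trans (cong (valΠ j) (divmod {q} n))
                            (proj₁ (BlockAt.block j (n / q) (n % q) (<⇒≤ (m%n<n n q))) a≤r)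

  split-high : ∀ j n → r j < n % q → valΠ j n ≡ suc (n / q) + valΠ (suc j) (suc (n / q))
  split-high j n r<a = trans (cong (valΠ j) (divmod {q} n))
                             (proj₂ (BlockAt.block j (n / q) (n % q) (<⇒≤ (m%n<n n q))) r<a)

  high-digit⇒< : ∀ j n → r j < n % q → val ((n / q) !) ≤ valΠ (suc j) (n / q) → val (n !) < valΠ j n
  high-digit⇒< j n r<a ih = begin-strict
    val (n !)                    ≡⟨ split-! n ⟩
    m + val (m !)                ≤⟨ +-monoʳ-≤ m ih ⟩
    m + valΠ (suc j) m           <⟨ n<1+n _ ⟩
    suc m + valΠ (suc j) m       ≤⟨ +-monoʳ-≤ (suc m) (val-∏-mono c m (s≢0 (suc j))) ⟩
    suc m + valΠ (suc j) (suc m) ≡⟨ sym (split-high j n r<a) ⟩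
    valΠ j n                     ∎
    where
    open ≤-Reasoning
    m = n / q

  val-!≤valΠ : ∀ n j → val (n !) ≤ valΠ j n
  val-!≤valΠ = <-rec _ step
    where
    step : ∀ n → (∀ {m} → m < n → ∀ j → val (m !) ≤ valΠ j m) → ∀ j → val (n !) ≤ valΠ j n
    step zero      _   j = ≤-refl
    step n@(suc _) rec j with n % q ≤? r j
    ... | yes a≤r = begin
      val (n !)                    ≡⟨ split-! n ⟩
      n / q + val ((n / q) !)      ≤⟨ +-monoʳ-≤ (n / q) (rec (m/n<m n q 1<q) (suc j)) ⟩
      n / q + valΠ (suc j) (n / q) ≡⟨ sym (split-low j n a≤r) ⟩
      valΠ j n                     ∎
      where open ≤-Reasoning
    ... | no a≰r = <⇒≤ (high-digit⇒< j n (≰⇒> a≰r) (rec (m/n<m n q 1<q) (suc j)))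

  digits-step : ∀ j n → n % q ≤ r j →
                (∀ i → digit q i (n / q) ≤ r (suc j + i)) ⇔ (∀ i → digit q i n ≤ r (j + i))
  digits-step j n a≤r = mk⇔
    (λ high → from (bound-j+0 , λ i → subst (digit q i (n / q) ≤_) (cong r (sym (+-suc j i))) (high i)))
    (λ bounded i → subst (digit q i (n / q) ≤_) (cong r (+-suc j i)) (proj₂ (to bounded) i))
    where
    P : ℕ → ℕ → Set
    P i d = d ≤ r (j + i)
    open Equivalence (digits-split {q} P n)
    bound-j+0 : n % q ≤ r (j + 0)
    bound-j+0 = subst (n % q ≤_) (cong r (sym (+-identityʳ j))) a≤r

  val-!≡valΠ⇔digits : ∀ n j → (val (n !) ≡ valΠ j n) ⇔ (∀ i → digit q i n ≤ r (j + i))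
  val-!≡valΠ⇔digits = <-rec _ step
    where
    step : ∀ n → (∀ {m} → m < n → ∀ j → (val (m !) ≡ valΠ j m) ⇔ (∀ i → digit q i m ≤ r (j + i))) →
           ∀ j → (val (n !) ≡ valΠ j n) ⇔ (∀ i → digit q i n ≤ r (j + i))
    step zero      _   j = mk⇔ (λ _ i → subst (_≤ r (j + i)) (sym (digit-of-0 i)) z≤n) (λ _ → refl)
    step n@(suc _) rec j with n % q ≤? r j
    ... | yes a≤r = digits-step j n a≤r ⇔-∘ (rec (m/n<m n q 1<q) (suc j) ⇔-∘ cancel)
      where
      cancel : (val (n !) ≡ valΠ j n) ⇔ (val ((n / q) !) ≡ valΠ (suc j) (n / q))
      cancel = mk⇔ (λ eq → +-cancelˡ-≡ (n / q) _ _ (trans (sym (split-! n)) (trans eq (split-low j n a≤r))))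
                   (λ eq → trans (split-! n) (trans (cong (n / q +_) eq) (sym (split-low j n a≤r))))
    ... | no a≰r = mk⇔ (λ eq → ⊥-elim (<-irrefl eq (high-digit⇒< j n (≰⇒> a≰r) (val-!≤valΠ (n / q) (suc j)))))
                       (λ bounded → ⊥-elim (a≰r (subst₂ _≤_ (digit-zero n) (cong r (+-identityʳ j)) (bounded 0))))

DigitBound : ℕ → ℕ → ℕ → Set
DigitBound p j d = ((j % 2 ≡ 1 ⊎ p % 3 ≡ 1) → 3 * d < p) × (¬ (j % 2 ≡ 1 ⊎ p % 3 ≡ 1) → 3 * d < 2 * p)

module _ {A X Y : Set} where

  cases-when : A → ((A → X) × (¬ A → Y)) ⇔ X
  cases-when a = mk⇔ (λ (x , _) → x a) (λ x → (λ _ → x) , (λ ¬a → ⊥-elim (¬a a)))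

  cases-unless : ¬ A → ((A → X) × (¬ A → Y)) ⇔ Y
  cases-unless ¬a = mk⇔ (λ (_ , y) → y ¬a) (λ y → (λ a → ⊥-elim (¬a a)) , (λ _ → y))

∀-⇔ : {P Q : ℕ → Set} → (∀ j → P j ⇔ Q j) → (∀ j → P j) ⇔ (∀ j → Q j)
∀-⇔ P⇔Q = mk⇔ (λ all j → Equivalence.to (P⇔Q j) (all j)) (λ all j → Equivalence.from (P⇔Q j) (all j))

≤⇔3*<3*+ : ∀ {d t k} → 0 < k → k ≤ 3 → (d ≤ t) ⇔ (3 * d < 3 * t + k)
≤⇔3*<3*+ {d} {t} {k} 0<k k≤3 = mk⇔ to from
  where
  to : d ≤ t → 3 * d < 3 * t + k
  to d≤t = begin-strict
    3 * d      ≤⟨ *-monoʳ-≤ 3 d≤t ⟩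
    3 * t      <⟨ m<m+n (3 * t) 0<k ⟩
    3 * t + k  ∎
    where open ≤-Reasoning
  from : 3 * d < 3 * t + k → d ≤ t
  from 3d<3t+k = ≤-pred (*-cancelˡ-< 3 d (suc t) (begin-strict
    3 * d        <⟨ 3d<3t+k ⟩
    3 * t + k    ≤⟨ +-monoʳ-≤ (3 * t) k≤3 ⟩
    3 * t + 3    ≡⟨ trans (+-comm (3 * t) 3) (sym (*-suc 3 t)) ⟩
    3 * suc t    ∎))
    where open ≤-Reasoning

prime[3] : Prime 3
prime[3] = from-yes (prime? 3)

module PrimeNot3 (q : ℕ) (qp : Prime q) (q≢3 : q ≢ 3) where
  open Valuation q qp

  q∤3 : ¬ q ∣ 3
  q∤3 q∣3 with prime⇒irreducible prime[3] q∣3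
  ... | inj₁ refl = <-irrefl refl 1<q
  ... | inj₂ q≡3  = q≢3 q≡3

  data ResidueMod3 : Set where
    ≡1mod3 : ∀ t → q ≡ 1 + 3 * t → ResidueMod3
    ≡2mod3 : ∀ t → q ≡ 2 + 3 * t → ResidueMod3

  residueMod3 : ResidueMod3
  residueMod3 = classify (q % 3) refl (m%n<n q 3)
    where
    q≡ : ∀ {k} → q % 3 ≡ k → q ≡ k + 3 * (q / 3)
    q≡ q%3≡k = trans (divmod {3} q) (cong (_+ 3 * (q / 3)) q%3≡k)
    classify : ∀ k → q % 3 ≡ k → k < 3 → ResidueMod3
    classify 0 q%3≡0 _ with prime⇒irreducible qp (divides (q / 3) (trans (q≡ q%3≡0) (*-comm 3 (q / 3))))
    ... | inj₁ ()
    ... | inj₂ 3≡q = ⊥-elim (q≢3 (sym 3≡q))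
    classify 1 q%3≡1 _ = ≡1mod3 (q / 3) (q≡ q%3≡1)
    classify 2 q%3≡2 _ = ≡2mod3 (q / 3) (q≡ q%3≡2)
    classify (suc (suc (suc _))) _ (s≤s (s≤s (s≤s ())))

  -- q = 1 + 3 t: all offsets are 1 and all bounds are t, since 3 t + 1 = q.
  module OneMod3 (t : ℕ) (q≡1+3t : q ≡ 1 + 3 * t) where
    private
      3t+1≡q : 3 * t + 1 ≡ q
      3t+1≡q = trans (+-comm (3 * t) 1) (sym q≡1+3t)

      t<q : t < q
      t<q = subst (t <_) (sym q≡1+3t) (s≤s (m≤n*m t 3))

    open DigitCriterion q qp q∤3 (λ _ → 1) (λ _ → t) (λ _ → t<q)
                        (λ _ → trans 3t+1≡q (sym (*-identityʳ q))) (λ _ ()) public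

    q%3≡1 : q % 3 ≡ 1
    q%3≡1 = trans (cong (_% 3) (trans q≡1+3t (cong (1 +_) (*-comm 3 t)))) ([m+kn]%n≡m%n 1 t 3)

    digitBound⇔ : ∀ j d → (d ≤ t) ⇔ DigitBound q j d
    digitBound⇔ j d = ⇔-sym (cases-when (inj₂ q%3≡1))
                  ⇔-∘ subst (λ x → (d ≤ t) ⇔ (3 * d < x)) 3t+1≡q (≤⇔3*<3*+ z<s (s≤s z≤n))

  -- q = 2 + 3 t: the offsets alternate 1, 2, 1, 2, ... with bounds
  -- 2 t + 1, t, 2 t + 1, t, ..., since 3 (2 t + 1) + 1 = 2 q and 3 t + 2 = q.
  module TwoMod3 (t : ℕ) (q≡2+3t : q ≡ 2 + 3 * t) where
    offset : ℕ → ℕ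
    offset j = 1 + j % 2

    bound : ℕ → ℕ
    bound zero          = 1 + 2 * t
    bound (suc zero)    = t
    bound (suc (suc j)) = bound j

    private
      3t+2≡q : 3 * t + 2 ≡ q
      3t+2≡q = trans (+-comm (3 * t) 2) (sym q≡2+3t)

      3[1+2t]+1≡2q : 3 * (1 + 2 * t) + 1 ≡ 2 * q
      3[1+2t]+1≡2q = trans (double t) (cong (2 *_) (sym q≡2+3t))
        where
        double : ∀ t → 3 * (1 + 2 * t) + 1 ≡ 2 * (2 + 3 * t)
        double = solve-∀

      bound<q : ∀ j → bound j < q
      bound<q zero          = subst (1 + 2 * t <_) (sym q≡2+3t) (s≤s (s≤s (*-monoˡ-≤ t (n≤1+n 2))))
      bound<q (suc zero)    = subst (t <_) (sym q≡2+3t) (≤-trans (s≤s (m≤n*m t 3)) (n≤1+n _))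
      bound<q (suc (suc j)) = bound<q j

      3*bound+offset : ∀ j → 3 * bound j + offset j ≡ q * offset (suc j)
      3*bound+offset zero          = trans 3[1+2t]+1≡2q (*-comm 2 q)
      3*bound+offset (suc zero)    = trans 3t+2≡q (sym (*-identityʳ q))
      3*bound+offset (suc (suc j)) = 3*bound+offset j

    open DigitCriterion q qp q∤3 offset bound bound<q 3*bound+offset (λ _ ()) public

    bound-by-parity : ∀ j → (j % 2 ≡ 0 × bound j ≡ 1 + 2 * t) ⊎ (j % 2 ≡ 1 × bound j ≡ t)
    bound-by-parity zero          = inj₁ (refl , refl)
    bound-by-parity (suc zero)    = inj₂ (refl , refl)
    bound-by-parity (suc (suc j)) = bound-by-parity j

    q%3≢1 : q % 3 ≢ 1
    q%3≢1 q%3≡1 with trans (sym q%3≡1) q%3≡2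
      where
      q%3≡2 : q % 3 ≡ 2
      q%3≡2 = trans (cong (_% 3) (trans q≡2+3t (cong (2 +_) (*-comm 3 t)))) ([m+kn]%n≡m%n 2 t 3)
    ... | ()

    digitBound⇔ : ∀ j d → (d ≤ bound j) ⇔ DigitBound q j d
    digitBound⇔ j d with bound-by-parity j
    ... | inj₁ (j%2≡0 , bound≡) rewrite bound≡ =
      ⇔-sym (cases-unless even)
        ⇔-∘ subst (λ x → (d ≤ 1 + 2 * t) ⇔ (3 * d < x)) 3[1+2t]+1≡2q (≤⇔3*<3*+ z<s (s≤s z≤n))
      where
      even : ¬ (j % 2 ≡ 1 ⊎ q % 3 ≡ 1)
      even (inj₁ j%2≡1) with trans (sym j%2≡0) j%2≡1
      ... | ()
      even (inj₂ q%3≡1) = q%3≢1 q%3≡1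
    ... | inj₂ (j%2≡1 , bound≡) rewrite bound≡ =
      ⇔-sym (cases-when (inj₁ j%2≡1))
        ⇔-∘ subst (λ x → (d ≤ t) ⇔ (3 * d < x)) 3t+2≡q (≤⇔3*<3*+ z<s (s≤s (s≤s z≤n)))

  val-!≤val-∏31 : ∀ n → val (n !) ≤ val (∏ 3 1 n)
  val-!≤val-∏31 n with residueMod3
  ... | ≡1mod3 t q≡ = OneMod3.val-!≤valΠ t q≡ n 0
  ... | ≡2mod3 t q≡ = TwoMod3.val-!≤valΠ t q≡ n 0

  val-!≡val-∏31⇔digitBounds : ∀ n → (val (n !) ≡ val (∏ 3 1 n)) ⇔ (∀ j → DigitBound q j (digit q j n))
  val-!≡val-∏31⇔digitBounds n with residueMod3
  ... | ≡1mod3 t q≡ = ∀-⇔ (λ j → digitBound⇔ j (digit q j n)) ⇔-∘ val-!≡valΠ⇔digits n 0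
    where open OneMod3 t q≡
  ... | ≡2mod3 t q≡ = ∀-⇔ (λ j → digitBound⇔ j (digit q j n)) ⇔-∘ val-!≡valΠ⇔digits n 0
    where open TwoMod3 t q≡

product-∣ : ∀ {as} → All Prime as → ∀ {b} → b ≢ 0 →
            (∀ q (qp : Prime q) → Valuation.val q qp (product as) ≤ Valuation.val q qp b) →
            product as ∣ b
product-∣ []                    {b} _   _       = 1∣ b
product-∣ {q ∷ as} (qp ∷ primes) {b} b≢0 val≤val = q*P∣b (val>0⇒∣ b≢0 0<val-b)
  where
  open Valuation q qp using (val>0⇒∣; val-q*)
  P = product as
  P≢0 : P ≢ 0
  P≢0 = ≢-nonZero⁻¹ P {{productOfPrimes≢0 primes}}
  0<val-b : 0 < Valuation.val q qp b
  0<val-b = ≤-trans (subst (0 <_) (sym (val-q* P≢0)) z<s) (val≤val q qp)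
  q*P∣b : q ∣ b → q * P ∣ b
  q*P∣b (divides b′ refl) = subst (q * P ∣_) (*-comm q b′) (*-monoʳ-∣ q (product-∣ primes b′≢0 val≤val′))
    where
    q≢0 : q ≢ 0
    q≢0 = ≢-nonZero⁻¹ q {{prime⇒nonZero qp}}
    b′≢0 : b′ ≢ 0
    b′≢0 refl = b≢0 refl
    val≤val′ : ∀ q′ (qp′ : Prime q′) → Valuation.val q′ qp′ P ≤ Valuation.val q′ qp′ b′
    val≤val′ q′ qp′ = +-cancelˡ-≤ (val q) _ _ (begin
      val q + val P    ≡⟨ sym (val-* q≢0 P≢0) ⟩
      val (q * P)      ≤⟨ val≤val q′ qp′ ⟩
      val (b′ * q)     ≡⟨ cong val (*-comm b′ q) ⟩
      val (q * b′)     ≡⟨ val-* q≢0 b′≢0 ⟩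
      val q + val b′   ∎)
      where
      open Valuation q′ qp′ using (val; val-*)
      open ≤-Reasoning

valuations⇒∣ : ∀ a .{{_ : NonZero a}} {b} → b ≢ 0 →
               (∀ q (qp : Prime q) → Valuation.val q qp a ≤ Valuation.val q qp b) → a ∣ b
valuations⇒∣ a {b} b≢0 val≤val = subst (_∣ b) (sym isFactorisation)
  (product-∣ factorsPrime b≢0 λ q qp → subst (λ x → Valuation.val q qp x ≤ Valuation.val q qp b) isFactorisation (val≤val q qp))
  where open PrimeFactorisation (factorise a)

3^n≢0 : ∀ n → 3 ^ n ≢ 0
3^n≢0 n = ≢-nonZero⁻¹ (3 ^ n) {{m^n≢0 3 n}}

prod3k+1≢0 : ∀ n → prod3k+1 n ≢ 0
prod3k+1≢0 n = subst (_≢ 0) (sym (prod3k+1≡∏ n)) (∏≢0 3 n (λ ()))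

3^n*prod≢0 : ∀ n → 3 ^ n * prod3k+1 n ≢ 0
3^n*prod≢0 n eq with m*n≡0⇒m≡0∨n≡0 (3 ^ n) eq
... | inj₁ 3^n≡0    = 3^n≢0 n 3^n≡0
... | inj₂ prod≡0 = prod3k+1≢0 n prod≡0

-- c(n,3) is an integer: n ! divides 3 ^ n * prod3k+1 n.  For q = 3 use
-- val (n !) ≤ n = val (3 ^ n); for q ≠ 3 use val (n !) ≤ val (∏ 3 1 n).
!∣3^n*prod3k+1 : ∀ n → n ! ∣ 3 ^ n * prod3k+1 n
!∣3^n*prod3k+1 n = valuations⇒∣ (n !) {{n !≢0}} (3^n*prod≢0 n) val-!≤
  where
  val-!≤ : ∀ q (qp : Prime q) → Valuation.val q qp (n !) ≤ Valuation.val q qp (3 ^ n * prod3k+1 n)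
  val-!≤ q qp = begin
    val (n !)                           ≤⟨ by-prime (q ≟ 3) ⟩
    val (3 ^ n) + val (∏ 3 1 n)         ≡⟨ cong (λ x → val (3 ^ n) + val x) (sym (prod3k+1≡∏ n)) ⟩
    val (3 ^ n) + val (prod3k+1 n)      ≡⟨ sym (val-* (3^n≢0 n) (prod3k+1≢0 n)) ⟩
    val (3 ^ n * prod3k+1 n)            ∎
    where
    open Valuation q qp
    open ≤-Reasoning
    by-prime : Dec (q ≡ 3) → val (n !) ≤ val (3 ^ n) + val (∏ 3 1 n)
    by-prime (yes refl) = ≤-trans (Legendre.val-!≤ 3 qp n) (≤-trans (≤-reflexive (sym (val-q^ n))) (m≤m+n _ _))
    by-prime (no q≢3)   = ≤-trans (PrimeNot3.val-!≤val-∏31 q qp q≢3 n) (m≤n+m _ _)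

-- For a prime p ≠ 3: p ∤ c(n,3) iff val_p (n !) = val_p (∏_{k<n} (3 k + 1)),
-- because c(n,3) * n ! = 3 ^ n * ∏_{k<n} (3 k + 1) and p ∤ 3 ^ n.
∤c3⇔val-!≡val-∏31 : ∀ p (pp : Prime p) → p ≢ 3 → ∀ n →
                     (¬ p ∣ c3 n) ⇔ (Valuation.val p pp (n !) ≡ Valuation.val p pp (∏ 3 1 n))
∤c3⇔val-!≡val-∏31 p pp p≢3 n = cancel ⇔-∘ subst (λ x → (¬ p ∣ x) ⇔ (val k ≡ 0)) (sym c3≡k) (∤⇔val≡0 k≢0)
  where
  open Valuation p pp
  open _∣_ (!∣3^n*prod3k+1 n) renaming (quotient to k; equality to X≡k*n!)

  c3≡k : c3 n ≡ k
  c3≡k = trans (cong (λ x → _/_ x (n !) {{n !≢0}}) X≡k*n!) (m*n/n≡m k (n !) {{n !≢0}})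

  k≢0 : k ≢ 0
  k≢0 k≡0 = 3^n*prod≢0 n (trans X≡k*n! (cong (_* n !) k≡0))

  val-k+val-! : val k + val (n !) ≡ val (∏ 3 1 n)
  val-k+val-! = begin
    val k + val (n !)                 ≡⟨ sym (val-* k≢0 (≢-nonZero⁻¹ (n !) {{n !≢0}})) ⟩
    val (k * n !)                     ≡⟨ cong val (sym X≡k*n!) ⟩
    val (3 ^ n * prod3k+1 n)          ≡⟨ val-* (3^n≢0 n) (prod3k+1≢0 n) ⟩
    val (3 ^ n) + val (prod3k+1 n)    ≡⟨ cong₂ _+_ (val-^-∤ n (PrimeNot3.q∤3 p pp p≢3)) (cong val (prod3k+1≡∏ n)) ⟩
    val (∏ 3 1 n)                     ∎
    where open ≡-Reasoning

  cancel : (val k ≡ 0) ⇔ (val (n !) ≡ val (∏ 3 1 n))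
  cancel = mk⇔ (λ val-k≡0 → trans (cong (_+ val (n !)) (sym val-k≡0)) val-k+val-!)
               (λ eq → +-cancelʳ-≡ (val (n !)) (val k) 0 (trans val-k+val-! (sym eq)))

theorem3p5 : (p : ℕ) (pp : Prime p) → p ≢ 3 → (n : ℕ) →
    (¬ (p ∣ c3 n)) ⇔
    (∀ j →
      ((j % 2 ≡ 1 ⊎ p % 3 ≡ 1) → 3 * digit p {{prime⇒nonZero pp}} j n < p) ×
      (¬ (j % 2 ≡ 1 ⊎ p % 3 ≡ 1) → 3 * digit p {{prime⇒nonZero pp}} j n < 2 * p))
theorem3p5 p pp p≢3 n =
  PrimeNot3.val-!≡val-∏31⇔digitBounds p pp p≢3 n ⇔-∘ ∤c3⇔val-!≡val-∏31 p pp p≢3 n
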